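{- Let $G$ be a connected graph of order $n$, and let $\mathcal{P}\subseteq\mathcal{L}(G)$ with $|\mathcal{P}|=3$. If $f(G,\mathcal{P})>0$, then $$n\geq \frac{3l(G)+\sum_{P\in\mathcal{P}}|X_{\mathcal{P}}(P)|+3}{2}.$$
   Context: All graphs are finite and simple. For a connected graph $G$, $l(G)$ is the length (number of edges) of a longest path in $G$ and $\mathcal{L}(G)$ is the set of paths in $G$ with exactly $l(G)+1$ vertices. For $U\subseteq V(G)$, $d_G(x,U)=\min_{y\in U} d_G(x,y)$, and for $\mathcal{P}\subseteq\mathcal{L}(G)$, $f(G,\mathcal{P})=\min\{\sum_{P\in\mathcal{P}} d_G(v,V(P))\mid v\in V(G)\}$. For a set $\mathcal{P}$ of paths and $P\in\mathcal{P}$, $X_{\mathcal{P}}(P)=V(P)\setminus\bigcup_{P'\in\mathcal{P}\setminus\{P\}}V(P')$. -}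

module Defs where

open import Data.Nat using (ℕ; zero; suc; _+_; _≤_; _<_)
open import Data.Fin using (Fin)
open import Data.Fin.Properties using (_≟_)
open import Data.List using (List; []; _∷_; length; filter; reverse)
open import Data.List.Membership.Propositional using (_∈_)
open import Data.List.Relation.Unary.Unique.Propositional using (Unique)
open import Data.List.Relation.Unary.Linked using (Linked)
open import Data.Product using (Σ; ∃; _×_; _,_)
open import Data.Sum using (_⊎_)
open import Data.Empty using (⊥)
open import Relation.Nullary using (¬_; ¬?)
open import Relation.Nullary.Decidable using (_⊎-dec_)
open import Relation.Binary.PropositionalEquality using (_≡_)

record Graph (n : ℕ) : Set₁ where
  field
    Adj   : Fin n → Fin n → Set
    sym   : ∀ {x y} → Adj x y → Adj y x
    irrefl : ∀ {x} → Adj x x → ⊥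
open Graph public

module _ {n : ℕ} (G : Graph n) where

  data Walk : Fin n → Fin n → ℕ → Set where
    here : ∀ {x} → Walk x x zero
    step : ∀ {x y z k} → Adj G x y → Walk y z k → Walk x z (suc k)

  Connected : Set
  Connected = ∀ x y → ∃ λ k → Walk x y k

  -- A path is given by its vertex sequence: distinct vertices, consecutive ones adjacent,
  -- at least one vertex.  Its length (number of edges) is (number of vertices) - 1.
  IsPath : List (Fin n) → Set
  IsPath vs = Unique vs × Linked (Adj G) vs × (1 ≤ length vs)

  IsLongestPathLength : ℕ → Set
  IsLongestPathLength l =
    (∃ λ vs → IsPath vs × length vs ≡ suc l) ×
    (∀ vs → IsPath vs → length vs ≤ suc l)

  InL : ℕ → List (Fin n) → Set
  InL l vs = IsPath vs × length vs ≡ suc l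

  IsDist : Fin n → Fin n → ℕ → Set
  IsDist x y k = Walk x y k × (∀ k' → Walk x y k' → k ≤ k')

  IsDistToSet : Fin n → List (Fin n) → ℕ → Set
  IsDistToSet x U k =
    (∃ λ y → y ∈ U × IsDist x y k) ×
    (∀ y k' → y ∈ U → IsDist x y k' → k ≤ k')

  IsDistSum3 : Fin n → List (Fin n) → List (Fin n) → List (Fin n) → ℕ → Set
  IsDistSum3 v P₁ P₂ P₃ s =
    ∃ λ k₁ → ∃ λ k₂ → ∃ λ k₃ →
      IsDistToSet v P₁ k₁ × IsDistToSet v P₂ k₂ × IsDistToSet v P₃ k₃ ×
      s ≡ k₁ + k₂ + k₃

  IsF3 : List (Fin n) → List (Fin n) → List (Fin n) → ℕ → Set
  IsF3 P₁ P₂ P₃ m =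
    (∃ λ v → IsDistSum3 v P₁ P₂ P₃ m) ×
    (∀ v s → IsDistSum3 v P₁ P₂ P₃ s → m ≤ s)

SamePath : ∀ {n} → List (Fin n) → List (Fin n) → Set
SamePath P Q = (P ≡ Q) ⊎ (P ≡ reverse Q)

-- |X_𝓟(P)| for 𝓟 = {P, Q, R}: number of vertices of P on neither Q nor R
-- (path vertices are distinct, so this counts the set).
Xsize : ∀ {n} → List (Fin n) → List (Fin n) → List (Fin n) → ℕ
Xsize {n} P Q R = length (filter (λ v → ¬? ((v ∈? Q) ⊎-dec (v ∈? R))) P)
  where open import Data.List.Membership.DecPropositional (_≟_ {n}) using (_∈?_)

module Submission where

-- Since f(G,𝓟) > 0, no vertex lies
-- on all three paths: such a vertex would have distance sum 0.  Give each
-- vertex v the weight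
--     w(v) = #{i | v ∈ Pᵢ} + #{i | v ∈ X_𝓟(Pᵢ)}.
-- A vertex on exactly one path has weight 1 + 1, on exactly two paths 2 + 0,
-- on none 0; hence w(v) ≤ 2 and Σ_v w(v) ≤ 2n.  On the other hand, counting
-- the vertices of a duplicate-free list as a sum of indicators over all
-- vertices gives Σ_v w(v) = 3(l+1) + Σᵢ |X_𝓟(Pᵢ)|, which is the claim.

open import Defs hiding (sym)
open import Data.Nat using (ℕ; zero; suc; _+_; _*_; _≤_; _<_; z≤n; s≤s)
open import Data.Nat.Properties
  using (+-0-commutativeMonoid; +-mono-≤; *-comm; ≤-trans; <-irrefl; module ≤-Reasoning)
open import Data.Fin using (Fin; zero; suc)
open import Data.Fin.Properties using (_≟_; suc-injective)
open import Data.List using (List; []; _∷_; length; filter)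
open import Data.List.Membership.Propositional using (_∈_; _∉_)
open import Data.List.Membership.Propositional.Properties using (∈-filter⁺; ∈-filter⁻)
import Data.List.Membership.DecPropositional as DecMembership
open import Data.List.Relation.Unary.Any using (here; there)
open import Data.List.Relation.Unary.Unique.Propositional using (Unique; []; _∷_)
open import Data.List.Relation.Unary.Unique.Propositional.Properties using (filter⁺)
open import Data.List.Relation.Unary.All.Properties using (All¬⇒¬Any)
open import Data.Product using (Σ; _×_; _,_)
open import Data.Sum using (_⊎_; inj₁; inj₂; [_,_])
open import Data.Bool using (if_then_else_)
open import Relation.Unary using (Pred; Decidable)
open import Relation.Nullary using (¬_; Dec; yes; no; does; ¬?; contradiction)
open import Relation.Nullary.Decidable using (_×-dec_; _⊎-dec_)
open import Relation.Binary.PropositionalEquality using (_≡_; refl; sym; trans; cong; cong₂; module ≡-Reasoning)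
open import Algebra.Properties.CommutativeMonoid.Sum +-0-commutativeMonoid
  using (sum; ∑-distrib-+; sum-cong-≗; sum-replicate-zero)
open import Data.Nat.Tactic.RingSolver using (solve-∀)

𝟙 : ∀ {p} {A : Set p} → Dec A → ℕ
𝟙 d = if does d then 1 else 0

module _ {p} {A : Set p} where

  𝟙-yes : A → (a : Dec A) → 𝟙 a ≡ 1
  𝟙-yes _ (yes _) = refl
  𝟙-yes x (no ¬x) = contradiction x ¬x

  𝟙-no : ¬ A → (a : Dec A) → 𝟙 a ≡ 0
  𝟙-no _  (no _)  = refl
  𝟙-no ¬x (yes x) = contradiction x ¬x

module _ {p q} {A : Set p} {B : Set q} where

  𝟙-cong : (A → B) → (B → A) → (a : Dec A) (b : Dec B) → 𝟙 a ≡ 𝟙 b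
  𝟙-cong A→B _   (yes x) b = sym (𝟙-yes (A→B x) b)
  𝟙-cong _   B→A (no ¬x) b = sym (𝟙-no (λ y → ¬x (B→A y)) b)

  𝟙-⊎ : ¬ (A × B) → (a : Dec A) (b : Dec B) → 𝟙 (a ⊎-dec b) ≡ 𝟙 a + 𝟙 b
  𝟙-⊎ excl (yes x) (yes y) = contradiction (x , y) excl
  𝟙-⊎ _    (yes _) (no _)  = refl
  𝟙-⊎ _    (no _)  (yes _) = refl
  𝟙-⊎ _    (no _)  (no _)  = refl

module _ {p q r} {A : Set p} {B : Set q} {C : Set r} where

  weight : Dec A → Dec B → Dec C → ℕ
  weight a b c =
    (𝟙 a + 𝟙 b + 𝟙 c) +
    (𝟙 (a ×-dec ¬? (b ⊎-dec c)) + 𝟙 (b ×-dec ¬? (a ⊎-dec c)) + 𝟙 (c ×-dec ¬? (a ⊎-dec b)))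

  -- Off the common part of the three paths the weight is at most 2:
  -- one path and exclusive there (1 + 1), two paths (2 + 0), or none (0).
  weight≤2 : ¬ (A × B × C) → (a : Dec A) (b : Dec B) (c : Dec C) → weight a b c ≤ 2
  weight≤2 none (yes x) (yes y) (yes z) = contradiction (x , y , z) none
  weight≤2 _    (yes _) (yes _) (no _)  = s≤s (s≤s z≤n)
  weight≤2 _    (yes _) (no _)  (yes _) = s≤s (s≤s z≤n)
  weight≤2 _    (yes _) (no _)  (no _)  = s≤s (s≤s z≤n)
  weight≤2 _    (no _)  (yes _) (yes _) = s≤s (s≤s z≤n)
  weight≤2 _    (no _)  (yes _) (no _)  = s≤s (s≤s z≤n)
  weight≤2 _    (no _)  (no _)  (yes _) = s≤s (s≤s z≤n)
  weight≤2 _    (no _)  (no _)  (no _)  = z≤n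

∑-zero : ∀ {n} (f : Fin n → ℕ) → (∀ v → f v ≡ 0) → sum f ≡ 0
∑-zero {n} f f≡0 = trans (sum-cong-≗ {n} {f} {λ _ → 0} f≡0) (sum-replicate-zero n)

∑-point : ∀ {n} (x : Fin n) → sum (λ v → 𝟙 (v ≟ x)) ≡ 1
∑-point {suc n} zero = cong suc (∑-zero {n} (λ i → 𝟙 (suc i ≟ zero)) (λ i → 𝟙-no (λ ()) (suc i ≟ zero)))
∑-point {suc n} (suc x) = begin
  sum (λ i → 𝟙 (suc i ≟ suc x)) ≡⟨ sum-cong-≗ (λ i → 𝟙-cong suc-injective (cong suc) (suc i ≟ suc x) (i ≟ x)) ⟩
  sum (λ i → 𝟙 (i ≟ x))         ≡⟨ ∑-point x ⟩
  1                             ∎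
  where open ≡-Reasoning

∑-distrib-+₃ : ∀ {n} (f g h : Fin n → ℕ) →
  sum (λ v → f v + g v + h v) ≡ sum f + sum g + sum h
∑-distrib-+₃ f g h = begin
  sum (λ v → f v + g v + h v)       ≡⟨ ∑-distrib-+ (λ v → f v + g v) h ⟩
  sum (λ v → f v + g v) + sum h     ≡⟨ cong (_+ sum h) (∑-distrib-+ f g) ⟩
  sum f + sum g + sum h             ∎
  where open ≡-Reasoning

∑-bound : ∀ {n} (f : Fin n → ℕ) (c : ℕ) → (∀ v → f v ≤ c) → sum f ≤ n * c
∑-bound {zero}  f c f≤c = z≤n
∑-bound {suc n} f c f≤c = +-mono-≤ (f≤c zero) (∑-bound (λ i → f (suc i)) c (λ i → f≤c (suc i)))

module Counting {n : ℕ} where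
  open DecMembership (_≟_ {n}) using (_∈?_)

  length-as-∑ : ∀ {ys : List (Fin n)} → Unique ys → length ys ≡ sum (λ v → 𝟙 (v ∈? ys))
  length-as-∑ {[]} [] = sym (∑-zero (λ v → 𝟙 (v ∈? [])) (λ v → 𝟙-no (λ ()) (v ∈? [])))
  length-as-∑ {x ∷ ys} (x≢ys ∷ u) = begin
    suc (length ys)                                   ≡⟨ cong suc (length-as-∑ u) ⟩
    1 + sum (λ v → 𝟙 (v ∈? ys))                       ≡⟨ cong (_+ sum (λ v → 𝟙 (v ∈? ys))) (sym (∑-point x)) ⟩
    sum (λ v → 𝟙 (v ≟ x)) + sum (λ v → 𝟙 (v ∈? ys))   ≡⟨ sym (∑-distrib-+ (λ v → 𝟙 (v ≟ x)) (λ v → 𝟙 (v ∈? ys))) ⟩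
    sum (λ v → 𝟙 (v ≟ x) + 𝟙 (v ∈? ys))               ≡⟨ sum-cong-≗ cons ⟩
    sum (λ v → 𝟙 (v ∈? x ∷ ys))                       ∎
    where
    open ≡-Reasoning
    x∉ys : x ∉ ys
    x∉ys = All¬⇒¬Any x≢ys
    cons : ∀ v → 𝟙 (v ≟ x) + 𝟙 (v ∈? ys) ≡ 𝟙 (v ∈? x ∷ ys)
    cons v = begin
      𝟙 (v ≟ x) + 𝟙 (v ∈? ys)       ≡⟨ sym (𝟙-⊎ (λ { (refl , v∈ys) → x∉ys v∈ys }) (v ≟ x) (v ∈? ys)) ⟩
      𝟙 ((v ≟ x) ⊎-dec (v ∈? ys))   ≡⟨ 𝟙-cong [ here , there ] split ((v ≟ x) ⊎-dec (v ∈? ys)) (v ∈? x ∷ ys) ⟩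
      𝟙 (v ∈? x ∷ ys)               ∎
      where
      split : v ∈ x ∷ ys → v ≡ x ⊎ v ∈ ys
      split (here v≡x)  = inj₁ v≡x
      split (there v∈ys) = inj₂ v∈ys

  length-filter-as-∑ : ∀ {p} {P : Pred (Fin n) p} (P? : Decidable P) {xs : List (Fin n)} →
    Unique xs → length (filter P? xs) ≡ sum (λ v → 𝟙 ((v ∈? xs) ×-dec P? v))
  length-filter-as-∑ P? {xs} u = begin
    length (filter P? xs)                      ≡⟨ length-as-∑ (filter⁺ P? u) ⟩
    sum (λ v → 𝟙 (v ∈? filter P? xs))          ≡⟨ sum-cong-≗ (λ v → 𝟙-cong (∈-filter⁻ P?) (λ (v∈xs , Pv) → ∈-filter⁺ P? v∈xs Pv)
                                                             (v ∈? filter P? xs) ((v ∈? xs) ×-dec P? v)) ⟩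
    sum (λ v → 𝟙 ((v ∈? xs) ×-dec P? v))       ∎
    where open ≡-Reasoning

  ∑-weight : ∀ {P₁ P₂ P₃ : List (Fin n)} → Unique P₁ → Unique P₂ → Unique P₃ →
    sum (λ v → weight (v ∈? P₁) (v ∈? P₂) (v ∈? P₃)) ≡
    (length P₁ + length P₂ + length P₃) + (Xsize P₁ P₂ P₃ + Xsize P₂ P₁ P₃ + Xsize P₃ P₁ P₂)
  ∑-weight {P₁} {P₂} {P₃} u₁ u₂ u₃ = begin
    sum (λ v → weight (v ∈? P₁) (v ∈? P₂) (v ∈? P₃))
      ≡⟨ ∑-distrib-+ (λ v → on P₁ v + on P₂ v + on P₃ v) exclusive-count ⟩
    sum (λ v → on P₁ v + on P₂ v + on P₃ v) + sum exclusive-count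
      ≡⟨ cong₂ _+_ (∑-distrib-+₃ (on P₁) (on P₂) (on P₃))
                   (∑-distrib-+₃ (exclusive P₁ P₂ P₃) (exclusive P₂ P₁ P₃) (exclusive P₃ P₁ P₂)) ⟩
    (sum (on P₁) + sum (on P₂) + sum (on P₃)) +
    (sum (exclusive P₁ P₂ P₃) + sum (exclusive P₂ P₁ P₃) + sum (exclusive P₃ P₁ P₂))
      ≡⟨ sym (cong₂ _+_
           (cong₂ _+_ (cong₂ _+_ (length-as-∑ u₁) (length-as-∑ u₂)) (length-as-∑ u₃))
           (cong₂ _+_ (cong₂ _+_ (length-filter-as-∑ _ u₁) (length-filter-as-∑ _ u₂)) (length-filter-as-∑ _ u₃))) ⟩
    (length P₁ + length P₂ + length P₃) + (Xsize P₁ P₂ P₃ + Xsize P₂ P₁ P₃ + Xsize P₃ P₁ P₂)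
      ∎
    where
    open ≡-Reasoning
    on : List (Fin n) → Fin n → ℕ
    on P v = 𝟙 (v ∈? P)
    exclusive : List (Fin n) → List (Fin n) → List (Fin n) → Fin n → ℕ
    exclusive P Q R v = 𝟙 ((v ∈? P) ×-dec ¬? ((v ∈? Q) ⊎-dec (v ∈? R)))
    exclusive-count : Fin n → ℕ
    exclusive-count v = exclusive P₁ P₂ P₃ v + exclusive P₂ P₁ P₃ v + exclusive P₃ P₁ P₂ v

module _ {n : ℕ} (G : Graph n) where

  dist-to-own-set : ∀ {v : Fin n} {U : List (Fin n)} → v ∈ U → IsDistToSet G v U 0
  dist-to-own-set {v} v∈U = (v , v∈U , here , λ _ _ → z≤n) , λ _ _ _ _ → z≤n

  positive-f⇒no-common-vertex : ∀ {P₁ P₂ P₃ : List (Fin n)} {m : ℕ} →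
    IsF3 G P₁ P₂ P₃ m → 0 < m → ∀ v → ¬ (v ∈ P₁ × v ∈ P₂ × v ∈ P₃)
  positive-f⇒no-common-vertex (_ , minimal) 0<m v (v∈P₁ , v∈P₂ , v∈P₃) =
    <-irrefl refl (≤-trans 0<m (minimal v 0 dist-sum-0))
    where
    dist-sum-0 : IsDistSum3 G v _ _ _ 0
    dist-sum-0 = 0 , 0 , 0 , dist-to-own-set v∈P₁ , dist-to-own-set v∈P₂ , dist-to-own-set v∈P₃ , refl

-- Three paths of length l contribute 3(l+1) vertex incidences.
three-paths : ∀ l x → suc l + suc l + suc l + x ≡ 3 * l + x + 3
three-paths = solve-∀

lemma2p1 : (n : ℕ) (G : Graph n) → Connected G →
    (l : ℕ) → IsLongestPathLength G l →
    (P₁ P₂ P₃ : List (Fin n)) →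
    InL G l P₁ → InL G l P₂ → InL G l P₃ →
    ¬ SamePath P₁ P₂ → ¬ SamePath P₁ P₃ → ¬ SamePath P₂ P₃ →
    Σ ℕ (λ m → IsF3 G P₁ P₂ P₃ m × 0 < m) →
    3 * l + (Xsize P₁ P₂ P₃ + Xsize P₂ P₁ P₃ + Xsize P₃ P₁ P₂) + 3 ≤ 2 * n
lemma2p1 n G _ l _ P₁ P₂ P₃ ((u₁ , _) , len₁) ((u₂ , _) , len₂) ((u₃ , _) , len₃) _ _ _ (_ , f , 0<m) =
  begin
    3 * l + X + 3                                     ≡⟨ sym (three-paths l X) ⟩
    suc l + suc l + suc l + X                         ≡⟨ cong (_+ X) (sym (cong₂ _+_ (cong₂ _+_ len₁ len₂) len₃)) ⟩
    length P₁ + length P₂ + length P₃ + X             ≡⟨ sym (∑-weight u₁ u₂ u₃) ⟩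
    sum (λ v → weight (v ∈? P₁) (v ∈? P₂) (v ∈? P₃))  ≤⟨ ∑-bound _ 2 (λ v → weight≤2 (no-common v) (v ∈? P₁) (v ∈? P₂) (v ∈? P₃)) ⟩
    n * 2                                             ≡⟨ *-comm n 2 ⟩
    2 * n                                             ∎
  where
  open ≤-Reasoning
  open Counting {n}
  open DecMembership (_≟_ {n}) using (_∈?_)
  X : ℕ
  X = Xsize P₁ P₂ P₃ + Xsize P₂ P₁ P₃ + Xsize P₃ P₁ P₂
  no-common : ∀ v → ¬ (v ∈ P₁ × v ∈ P₂ × v ∈ P₃)
  no-common = positive-f⇒no-common-vertex G f 0<m
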